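{- Let $k,q\ge 2$ be integers. Let $X$ be a graph and let $Y_1,Y_2$ be two $S_k$-covering graphs of $X$ (equivalently, two $UG(k)$ instances on the same constraint graph $X$, with edge permutations $g^{(1)}_{ij}$ and $g^{(2)}_{ij}$ respectively) which are isomorphic as $S_k$-covering graphs. For $\ell=1,2$ let $W_\ell$ be the constraint graph and $Z_\ell$ the label-extended graph of the $\Gamma$-Max-2Lin$(\mathbb{Z}/q\mathbb{Z})$ instance obtained by applying the KKMO construction (described in the context) to $Y_\ell$. Then the KKMO construction gives a well-defined map from isomorphism classes of $S_k$-covering graphs to isomorphism classes of $\mathbb{Z}/q\mathbb{Z}$-covering graphs; concretely, there is a graph isomorphism $\varphi\colon W_1\to W_2$ sending each vertex $(i,[p])$ to a vertex of the form $(i,[p'])$ (same $i\in V(X)$), and elements $c_w\in\mathbb{Z}/q\mathbb{Z}$ for $w\in V(W_1)$, such that for every edge $e$ of $W_1$ between $w$ and $w'$ carrying the constraint $x_w-x_{w'}=a_e$ in the first output instance, the edge $\varphi(e)$ of $W_2$ carries the constraint $x_{\varphi(w)}-x_{\varphi(w')}=a_e+c_w-c_{w'}$ in the second output instance; i.e. $Z_2$, viewed over $W_1$ via $\varphi$, is isomorphic to $Z_1$ as a $\mathbb{Z}/q\mathbb{Z}$-covering graph.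
   Context: Let $G$ be a group of permutations of $[k]$. A $G$-covering graph of a graph $X$ is specified by an element $g_{ij}\in G$ for each directed edge $(i,j)$ of $X$ (with $g_{ji}=g_{ij}^{ -1}$); it is the graph $Y$ on $V(X)\times[k]$ with an edge between $(i,a)$ and $(j,g_{ij}(a))$ for every edge $(i,j)$ of $X$ and $a\in[k]$, together with the projection to $X$. A $UG(k)$ instance with constraint graph $X$ and constraints $x_j=g_{ij}(x_i)$ is the same as an $S_k$-covering graph (its label-extended graph). Two $G$-covering graphs $Y_1,Y_2$ of $X$ (labels $g^{(1)},g^{(2)}$) are isomorphic as $G$-covering graphs if there are $\sigma_i\in G$ ($i\in V(X)$) with $g^{(2)}_{ij}=\sigma_j\circ g^{(1)}_{ij}\circ\sigma_i^{ -1}$ for all directed edges, i.e. the fiberwise relabeling $(i,a)\mapsto(i,\sigma_i(a))$ is an isomorphism $Y_1\to Y_2$ commuting with the projections. An instance of $\Gamma$-Max-2Lin$(\mathbb{Z}/q\mathbb{Z})$ on a graph $W$ has constraints $x_w-x_{w'}=a_e$, $a_e\in\mathbb{Z}/q\mathbb{Z}$, one per edge $e$; its label-extended graph (a $\mathbb{Z}/q\mathbb{Z}$-covering graph, $\mathbb{Z}/q\mathbb{Z}$ acting on itself by translation) has an edge between $(w,b)$ and $(w',b')$ iff $b-b'=a_e$. KKMO construction (Khot–Kindler–Mossel–O'Donnell), applied to a $UG(k)$ instance $(X,\{g_{ij}\})$, ignoring the edge weights it introduces: (1) Squaring: form the multigraph $X^2$ on $V(X)$ having, for every vertex $m$ and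 every pair of edges $\{i,m\},\{m,j\}$ of $X$, an edge from $i$ to $j$ with permutation $g_{mj}\circ g_{im}$. (2)–(3) Vector bundling and folding: the new vertex set is the set of pairs $(i,[p])$ with $i\in V(X)$, $p=(p_1,\dots,p_k)\in(\mathbb{Z}/q\mathbb{Z})^k$, and $[p]$ the class of $p$ modulo adding constant vectors $(c,\dots,c)$. For $\sigma\in S_k$ let $p^\sigma$ be defined by $(p^\sigma)_s=p_{\sigma^{ -1}(s)}$ (well defined on classes). (4) Constraints: for each edge from $i$ to $j$ in $X^2$ with permutation $\pi$ and each class $[p]$, put an edge between $(i,[p])$ and $(j,[p^\pi])$ with constraint $x_{(i,[p])}-x_{(j,[p^\pi])}=p_1-p_{\pi^{ -1}(1)}$ (well defined on classes). The resulting graph is the constraint graph $W$ of the output $\Gamma$-Max-2Lin$(\mathbb{Z}/q\mathbb{Z})$ instance. -}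

module Defs where

open import Data.Nat using (ℕ; zero; suc; _+_; _∸_)
open import Data.Nat.DivMod using (_%_; m%n<n)
open import Data.Fin using (Fin; zero; suc; toℕ; fromℕ<)
open import Data.Fin.Permutation using (Permutation′; _⟨$⟩ʳ_; _⟨$⟩ˡ_; _∘ₚ_; flip)
open import Data.Vec using (Vec; lookup; tabulate)
open import Data.Bool using (Bool; true; false)
open import Data.Empty using (⊥)
open import Data.Product using (Σ; _×_; _,_; proj₁; proj₂)
open import Data.Sum using (_⊎_)
open import Relation.Binary.PropositionalEquality using (_≡_)
open import Function.Bundles using (_↔_; Inverse)

-- ℤ/qℤ, represented by Fin q with modular arithmetic

infixl 6 _+q_ _-q_

_+q_ : ∀ {q} → Fin q → Fin q → Fin q
_+q_ {suc q} a b = fromℕ< (m%n<n (toℕ a + toℕ b) (suc q))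

-q_ : ∀ {q} → Fin q → Fin q
-q_ {suc q} a = fromℕ< (m%n<n (suc q ∸ toℕ a) (suc q))

_-q_ : ∀ {q} → Fin q → Fin q → Fin q
a -q b = a +q (-q b)

-- A (multi)graph X with vertex set Fin nV and edge set Fin nE;
-- each edge e is stored with an orientation src e → tgt e.

record Graph : Set where
  field
    nV nE : ℕ
    src tgt : Fin nE → Fin nV

open Graph public

-- An S_k-covering graph (= UG(k) instance) of X: a permutation g_e of
-- Fin k for every edge e, for the stored direction src e → tgt e;
-- the reverse direction carries the inverse permutation.
SkCover : Graph → ℕ → Set
SkCover X k = Fin (nE X) → Permutation′ k

IsoCover : (X : Graph) (k : ℕ) → SkCover X k → SkCover X k → Set
IsoCover X k g₁ g₂ =
  Σ (Fin (nV X) → Permutation′ k) λ σ →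
    ∀ (e : Fin (nE X)) (a : Fin k) →
      g₂ e ⟨$⟩ʳ a ≡ σ (tgt X e) ⟨$⟩ʳ (g₁ e ⟨$⟩ʳ (σ (src X e) ⟨$⟩ˡ a))

Dart : Graph → Set
Dart X = Fin (nE X) × Bool

dsrc dtgt : (X : Graph) → Dart X → Fin (nV X)
dsrc X (e , true)  = src X e
dsrc X (e , false) = tgt X e
dtgt X (e , true)  = tgt X e
dtgt X (e , false) = src X e

dperm : ∀ {X k} → SkCover X k → Dart X → Permutation′ k
dperm g (e , true)  = g e
dperm g (e , false) = flip (g e)

-- An edge of X² is an ordered pair of edges {i,m},{m,j}
-- sharing the middle vertex m, i.e. a pair of darts d₁ : i → m and
-- d₂ : m → j; it goes from i to j with permutation g_mj ∘ g_im.

SqEdge : Graph → Set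
SqEdge X = Σ (Dart X × Dart X) λ d → dtgt X (proj₁ d) ≡ dsrc X (proj₂ d)

sqSrc sqTgt : (X : Graph) → SqEdge X → Fin (nV X)
sqSrc X ((d₁ , d₂) , _) = dsrc X d₁
sqTgt X ((d₁ , d₂) , _) = dtgt X d₂

-- g_mj ∘ g_im  (note: π₁ ∘ₚ π₂ applies π₁ first)
sqPerm : ∀ {X k} → SkCover X k → SqEdge X → Permutation′ k
sqPerm {X} g ((d₁ , d₂) , _) = dperm {X} g d₁ ∘ₚ dperm {X} g d₂

-- (2)-(3) Classes [p] of p ∈ (ℤ/qℤ)^k modulo constant vectors.
-- For k, q ≥ 1 the class [p] is represented faithfully by the vector
-- (p_{s+1} - p_1)_{s} ∈ (ℤ/qℤ)^(k-1) (canonical representative with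
-- first coordinate 0).  The cases k = 0 or q = 0 are junk (excluded
-- by the hypotheses k, q ≥ 2) and are made empty.

Cls : ℕ → ℕ → Set
Cls zero    q       = ⊥
Cls (suc k) zero    = ⊥
Cls (suc k) (suc q) = Vec (Fin (suc q)) k

rep : ∀ {k q} → Cls k q → Fin k → Fin q
rep {zero}  {q}     () s
rep {suc k} {zero}  () s
rep {suc k} {suc q} c zero    = zero
rep {suc k} {suc q} c (suc s) = lookup c s

cls : ∀ {k q} → (Fin (suc k) → Fin (suc q)) → Cls (suc k) (suc q)
cls p = tabulate λ s → p (suc s) -q p zero

-- [p] ↦ [p^σ],  (p^σ)_s = p_{σ⁻¹(s)}
act : ∀ {k q} → Permutation′ k → Cls k q → Cls k q
act {zero}  {q}     σ ()
act {suc k} {zero}  σ ()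
act {suc k} {suc q} σ c = cls λ s → rep c (σ ⟨$⟩ˡ s)

-- the constraint constant p_1 - p_{π⁻¹(1)} (index 1 is Fin.zero)
kkmoLabel : ∀ {k q} → Permutation′ k → Cls k q → Fin q
kkmoLabel {zero}  {q}     π ()
kkmoLabel {suc k} {zero}  π ()
kkmoLabel {suc k} {suc q} π c = rep c zero -q rep c (π ⟨$⟩ˡ zero)

-- Γ-Max-2Lin(ℤ/qℤ) instances: an (undirected multi)graph whose edges
-- are stored with an orientation src e → tgt e and carry the constraint
-- x_{src e} - x_{tgt e} = label e.

record LinInstance (q : ℕ) : Set₁ where
  field
    V E : Set
    lsrc ltgt : E → V
    label : E → Fin q

open LinInstance public

KKMO : (k q : ℕ) (X : Graph) → SkCover X k → LinInstance q
KKMO k q X g = record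
  { V     = Fin (nV X) × Cls k q
  ; E     = SqEdge X × Cls k q
  ; lsrc  = λ { (s , c) → sqSrc X s , c }
  ; ltgt  = λ { (s , c) → sqTgt X s , act (sqPerm g s) c }
  ; label = λ { (s , c) → kkmoLabel (sqPerm g s) c }
  }

record CoverIso {q : ℕ} (I J : LinInstance q) : Set where
  field
    φV : V I ↔ V J
    φE : E I ↔ E J
    c  : V I → Fin q
    resp : ∀ (e : E I) →
      let w  = lsrc I e
          w' = ltgt I e
          e' = Inverse.to φE e
          a  = label I e +q c w -q c w'
      in (lsrc J e' ≡ Inverse.to φV w × ltgt J e' ≡ Inverse.to φV w'
            × label J e' ≡ a)
         ⊎ (lsrc J e' ≡ Inverse.to φV w' × ltgt J e' ≡ Inverse.to φV w
            × label J e' ≡ -q a)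

-- Let σ_i ∈ S_k (i ∈ V(X)) be a fibrewise relabelling with
-- g²_e = σ_tgt ∘ g¹_e ∘ σ_src⁻¹.  The isomorphism of the two output
-- instances sends a vertex (i,[p]) to (i,[p^{σ_i}]) and an edge
-- (s,[p]) of X² × classes to (s,[p^{σ_i}]), i the source of s; the vertex
-- shifts are c_(i,[p]) = p_{σ_i⁻¹(1)} - p_1.
-- The construction works for all k, q ≥ 1; the hypotheses k, q ≥ 2 of
-- Proposition 19 serve only to exclude the degenerate (empty) cases.
module Submission where

open import Defs
open import Data.Nat using (ℕ; _≤_)
open import Data.Product using (Σ; proj₁)
open import Relation.Binary.PropositionalEquality using (_≡_)
open import Function.Bundles using (Inverse)

open import Level using (0ℓ)
open import Algebra.Bundles using (AbelianGroup)
open import Algebra.Structures using (IsAbelianGroup)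
open import Data.Nat as ℕ using (suc; s≤s)
open import Data.Nat.Properties using (+-comm; +-assoc; m+[n∸m]≡n; <⇒≤)
open import Data.Nat.DivMod using (_%_; %-distribˡ-+; m%n%n≡m%n; m<n⇒m%n≡m; n%n≡0)
open import Data.Fin using (Fin; zero; suc; toℕ)
open import Data.Fin.Properties using (toℕ-fromℕ<; toℕ-injective; toℕ<n)
open import Data.Fin.Permutation as Perm using (Permutation′; _⟨$⟩ʳ_; _⟨$⟩ˡ_; flip)
open import Data.Vec using (lookup)
open import Data.Vec.Properties using (lookup∘tabulate; tabulate∘lookup; tabulate-cong)
open import Data.Product using (_×_; _,_; proj₂)
open import Data.Sum using (inj₁)
open import Data.Bool using (true; false)
open import Function using (_∘_; _↔_; mk↔ₛ′)
open import Relation.Binary.PropositionalEquality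
  using (refl; sym; trans; cong; cong₂; module ≡-Reasoning)
open import Relation.Binary.PropositionalEquality.Algebra using (isMagma)

module ModularArithmetic (q : ℕ) where

  n : ℕ
  n = suc q

  toℕ-+q : ∀ (a b : Fin n) → toℕ (a +q b) ≡ (toℕ a ℕ.+ toℕ b) % n
  toℕ-+q a b = toℕ-fromℕ< _

  %-absorbˡ : ∀ x y → (x % n ℕ.+ y) % n ≡ (x ℕ.+ y) % n
  %-absorbˡ x y = begin
    (x % n ℕ.+ y) % n           ≡⟨ %-distribˡ-+ (x % n) y n ⟩
    (x % n % n ℕ.+ y % n) % n   ≡⟨ cong (λ t → (t ℕ.+ y % n) % n) (m%n%n≡m%n x n) ⟩
    (x % n ℕ.+ y % n) % n       ≡⟨ %-distribˡ-+ x y n ⟨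
    (x ℕ.+ y) % n               ∎
    where open ≡-Reasoning

  %-absorbʳ : ∀ x y → (x ℕ.+ y % n) % n ≡ (x ℕ.+ y) % n
  %-absorbʳ x y = begin
    (x ℕ.+ y % n) % n   ≡⟨ cong (_% n) (+-comm x (y % n)) ⟩
    (y % n ℕ.+ x) % n   ≡⟨ %-absorbˡ y x ⟩
    (y ℕ.+ x) % n       ≡⟨ cong (_% n) (+-comm y x) ⟩
    (x ℕ.+ y) % n       ∎
    where open ≡-Reasoning

  +q-assoc : ∀ (a b c : Fin n) → (a +q b) +q c ≡ a +q (b +q c)
  +q-assoc a b c = toℕ-injective (begin
    toℕ ((a +q b) +q c)                     ≡⟨ toℕ-+q (a +q b) c ⟩
    (toℕ (a +q b) ℕ.+ toℕ c) % n            ≡⟨ cong (λ t → (t ℕ.+ toℕ c) % n) (toℕ-+q a b) ⟩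
    ((x ℕ.+ y) % n ℕ.+ z) % n               ≡⟨ %-absorbˡ (x ℕ.+ y) z ⟩
    (x ℕ.+ y ℕ.+ z) % n                     ≡⟨ cong (_% n) (+-assoc x y z) ⟩
    (x ℕ.+ (y ℕ.+ z)) % n                   ≡⟨ %-absorbʳ x (y ℕ.+ z) ⟨
    (x ℕ.+ (y ℕ.+ z) % n) % n               ≡⟨ cong (λ t → (x ℕ.+ t) % n) (toℕ-+q b c) ⟨
    (x ℕ.+ toℕ (b +q c)) % n                ≡⟨ toℕ-+q a (b +q c) ⟨
    toℕ (a +q (b +q c))                     ∎)
    where
    open ≡-Reasoning
    x = toℕ a
    y = toℕ b
    z = toℕ c

  +q-comm : ∀ (a b : Fin n) → a +q b ≡ b +q a
  +q-comm a b = toℕ-injective (begin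
    toℕ (a +q b)               ≡⟨ toℕ-+q a b ⟩
    (toℕ a ℕ.+ toℕ b) % n      ≡⟨ cong (_% n) (+-comm (toℕ a) (toℕ b)) ⟩
    (toℕ b ℕ.+ toℕ a) % n      ≡⟨ toℕ-+q b a ⟨
    toℕ (b +q a)               ∎)
    where open ≡-Reasoning

  +q-identityˡ : ∀ (a : Fin n) → zero +q a ≡ a
  +q-identityˡ a = toℕ-injective (trans (toℕ-+q zero a) (m<n⇒m%n≡m (toℕ<n a)))

  +q-inverseʳ : ∀ (a : Fin n) → a +q (-q a) ≡ zero
  +q-inverseʳ a = toℕ-injective (begin
    toℕ (a +q (-q a))                    ≡⟨ toℕ-+q a (-q a) ⟩
    (toℕ a ℕ.+ toℕ (-q a)) % n           ≡⟨ cong (λ t → (toℕ a ℕ.+ t) % n) (toℕ-fromℕ< _) ⟩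
    (toℕ a ℕ.+ (n ℕ.∸ toℕ a) % n) % n    ≡⟨ %-absorbʳ (toℕ a) (n ℕ.∸ toℕ a) ⟩
    (toℕ a ℕ.+ (n ℕ.∸ toℕ a)) % n        ≡⟨ cong (_% n) (m+[n∸m]≡n (<⇒≤ (toℕ<n a))) ⟩
    n % n                                ≡⟨ n%n≡0 n ⟩
    0                                    ∎)
    where open ≡-Reasoning

  +q-isAbelianGroup : IsAbelianGroup _≡_ _+q_ zero (λ a → -q a)
  +q-isAbelianGroup = record
    { isGroup = record
      { isMonoid = record
        { isSemigroup = record { isMagma = isMagma _+q_ ; assoc = +q-assoc }
        ; identity    = +q-identityˡ , λ a → trans (+q-comm a zero) (+q-identityˡ a)
        }
      ; inverse = (λ a → trans (+q-comm (-q a) a) (+q-inverseʳ a)) , +q-inverseʳ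
      ; ⁻¹-cong = cong (λ a → -q a)
      }
    ; comm = +q-comm
    }

  ℤ/n : AbelianGroup 0ℓ 0ℓ
  ℤ/n = record { isAbelianGroup = +q-isAbelianGroup }

module Differences {a ℓ} (G : AbelianGroup a ℓ) where

  open AbelianGroup G
  open import Algebra.Properties.AbelianGroup G using (⁻¹-anti-homo‿-; ε⁻¹≈ε)
  open import Relation.Binary.Reasoning.Setoid setoid

  -‿identityʳ : ∀ x → x - ε ≈ x
  -‿identityʳ x = begin
    x ∙ ε ⁻¹    ≈⟨ ∙-congˡ ε⁻¹≈ε ⟩
    x ∙ ε       ≈⟨ identityʳ x ⟩
    x           ∎

  -- a difference does not change when both terms are shifted by the same a;
  -- this makes the difference of two coordinates of a class well defined
  -‿shift : ∀ x y a → (x - a) - (y - a) ≈ x - y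
  -‿shift x y a = begin
    (x - a) - (y - a)              ≈⟨ ∙-congˡ (⁻¹-anti-homo‿- y a) ⟩
    (x - a) ∙ (a - y)              ≈⟨ assoc x (a ⁻¹) (a - y) ⟩
    x ∙ (a ⁻¹ ∙ (a - y))           ≈⟨ ∙-congˡ (assoc (a ⁻¹) a (y ⁻¹)) ⟨
    x ∙ ((a ⁻¹ ∙ a) - y)           ≈⟨ ∙-congˡ (∙-congʳ (inverseˡ a)) ⟩
    x ∙ (ε - y)                    ≈⟨ ∙-congˡ (identityˡ (y ⁻¹)) ⟩
    x - y                          ∎

  -- the shape in which the KKMO constants of the two instances are compared:
  -- ε - (z - x) is (ε - y) + x, corrected by the difference z - y
  shifted-difference : ∀ x y z → ε - (z - x) ≈ ((ε - y) ∙ x) - (z - y)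
  shifted-difference x y z = begin
    ε - (z - x)                    ≈⟨ identityˡ ((z - x) ⁻¹) ⟩
    (z - x) ⁻¹                     ≈⟨ ⁻¹-anti-homo‿- z x ⟩
    x - z                          ≈⟨ -‿shift x z y ⟨
    (x - y) - (z - y)              ≈⟨ ∙-congʳ (comm x (y ⁻¹)) ⟩
    (y ⁻¹ ∙ x) - (z - y)           ≈⟨ ∙-congʳ (∙-congʳ (identityˡ (y ⁻¹))) ⟨
    ((ε - y) ∙ x) - (z - y)        ∎

module Classes (k q : ℕ) where

  open ModularArithmetic q using (n; ℤ/n; +q-inverseʳ)
  open Differences ℤ/n using (-‿identityʳ; -‿shift)

  K : ℕ
  K = suc k

  Class : Set
  Class = Cls K n

  -- pullback along a map of coordinates, [p] ↦ [p ∘ f]; for a permutation σ,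
  -- act σ = pull (σ⁻¹) holds by definition
  pull : (Fin K → Fin K) → Class → Class
  pull f c = cls (rep c ∘ f)

  rep-cls : ∀ (p : Fin K → Fin n) s → rep {K} (cls p) s ≡ p s -q p zero
  rep-cls p zero    = sym (+q-inverseʳ (p zero))
  rep-cls p (suc s) = lookup∘tabulate _ s

  pull-id : ∀ c → pull (λ s → s) c ≡ c
  pull-id c = trans (tabulate-cong λ s → -‿identityʳ (lookup c s)) (tabulate∘lookup c)

  pull-cong : ∀ {f h} c → (∀ s → f s ≡ h s) → pull f c ≡ pull h c
  pull-cong c f≗h = tabulate-cong λ s →
    cong₂ _-q_ (cong (rep c) (f≗h (suc s))) (cong (rep c) (f≗h zero))

  pull-∘ : ∀ f h c → pull f (pull h c) ≡ pull (h ∘ f) c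
  pull-∘ f h c = tabulate-cong λ s → begin
    rep (pull h c) (f (suc s)) -q rep (pull h c) (f zero)
      ≡⟨ cong₂ _-q_ (rep-cls (rep c ∘ h) (f (suc s))) (rep-cls (rep c ∘ h) (f zero)) ⟩
    (rep c (h (f (suc s))) -q r₀) -q (rep c (h (f zero)) -q r₀)
      ≡⟨ -‿shift (rep c (h (f (suc s)))) (rep c (h (f zero))) r₀ ⟩
    rep c (h (f (suc s))) -q rep c (h (f zero))
      ∎
    where
    open ≡-Reasoning
    r₀ = rep c (h zero)

  pull-inverse : ∀ f h c → (∀ s → h (f s) ≡ s) → pull f (pull h c) ≡ c
  pull-inverse f h c h∘f≗id =
    trans (pull-∘ f h c) (trans (pull-cong c h∘f≗id) (pull-id c))

  act↔ : Permutation′ K → Class ↔ Class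
  act↔ σ = mk↔ₛ′ (act σ) (act (flip σ))
    (λ c → pull-inverse (σ ⟨$⟩ˡ_) (σ ⟨$⟩ʳ_) c (λ _ → Perm.inverseʳ σ))
    (λ c → pull-inverse (σ ⟨$⟩ʳ_) (σ ⟨$⟩ˡ_) c (λ _ → Perm.inverseˡ σ))

fibrewise↔ : {A B : Set} → (A → B ↔ B) → (A × B) ↔ (A × B)
fibrewise↔ f = mk↔ₛ′
  (λ (a , b) → a , Inverse.to (f a) b)
  (λ (a , b) → a , Inverse.from (f a) b)
  (λ (a , b) → cong (a ,_) (Inverse.strictlyInverseˡ (f a) b))
  (λ (a , b) → cong (a ,_) (Inverse.strictlyInverseʳ (f a) b))

module Conjugate {k} (π₁ π₂ ρ τ : Permutation′ k)
                 (conj : ∀ a → π₂ ⟨$⟩ʳ a ≡ τ ⟨$⟩ʳ (π₁ ⟨$⟩ʳ (ρ ⟨$⟩ˡ a))) where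

  conj-forward : ∀ a → τ ⟨$⟩ˡ (π₂ ⟨$⟩ʳ a) ≡ π₁ ⟨$⟩ʳ (ρ ⟨$⟩ˡ a)
  conj-forward a = trans (cong (τ ⟨$⟩ˡ_) (conj a)) (Perm.inverseˡ τ)

  conj-backward : ∀ b → ρ ⟨$⟩ˡ (π₂ ⟨$⟩ˡ b) ≡ π₁ ⟨$⟩ˡ (τ ⟨$⟩ˡ b)
  conj-backward b = begin
    ρ ⟨$⟩ˡ (π₂ ⟨$⟩ˡ b)                         ≡⟨ Perm.inverseˡ π₁ ⟨
    π₁ ⟨$⟩ˡ (π₁ ⟨$⟩ʳ (ρ ⟨$⟩ˡ (π₂ ⟨$⟩ˡ b)))      ≡⟨ cong (π₁ ⟨$⟩ˡ_) (conj-forward (π₂ ⟨$⟩ˡ b)) ⟨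
    π₁ ⟨$⟩ˡ (τ ⟨$⟩ˡ (π₂ ⟨$⟩ʳ (π₂ ⟨$⟩ˡ b)))      ≡⟨ cong (λ t → π₁ ⟨$⟩ˡ (τ ⟨$⟩ˡ t)) (Perm.inverseʳ π₂) ⟩
    π₁ ⟨$⟩ˡ (τ ⟨$⟩ˡ b)                         ∎
    where open ≡-Reasoning

module Relabelling {k} (X : Graph) (g₁ g₂ : SkCover X k) (iso : IsoCover X k g₁ g₂) where

  σ : Fin (nV X) → Permutation′ k
  σ = proj₁ iso

  dart-conj : ∀ d b → σ (dsrc X d) ⟨$⟩ˡ (dperm {X} g₂ d ⟨$⟩ˡ b)
                    ≡ dperm {X} g₁ d ⟨$⟩ˡ (σ (dtgt X d) ⟨$⟩ˡ b)
  dart-conj (e , true)  = Conjugate.conj-backward (g₁ e) (g₂ e) (σ (src X e)) (σ (tgt X e)) (proj₂ iso e)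
  dart-conj (e , false) = Conjugate.conj-forward  (g₁ e) (g₂ e) (σ (src X e)) (σ (tgt X e)) (proj₂ iso e)

  -- the permutation of a path i → m → j is conjugated via σ_i and σ_j
  -- because the two middle relabellings σ_m cancel
  sq-conj : ∀ s b → σ (sqSrc X s) ⟨$⟩ˡ (sqPerm {X} g₂ s ⟨$⟩ˡ b)
                  ≡ sqPerm {X} g₁ s ⟨$⟩ˡ (σ (sqTgt X s) ⟨$⟩ˡ b)
  sq-conj ((d₁ , d₂) , m) b = begin
    σ (dsrc X d₁) ⟨$⟩ˡ (P₂ ⟨$⟩ˡ (Q₂ ⟨$⟩ˡ b))   ≡⟨ dart-conj d₁ (Q₂ ⟨$⟩ˡ b) ⟩
    P₁ ⟨$⟩ˡ (σ (dtgt X d₁) ⟨$⟩ˡ (Q₂ ⟨$⟩ˡ b))   ≡⟨ cong (λ v → P₁ ⟨$⟩ˡ (σ v ⟨$⟩ˡ (Q₂ ⟨$⟩ˡ b))) m ⟩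
    P₁ ⟨$⟩ˡ (σ (dsrc X d₂) ⟨$⟩ˡ (Q₂ ⟨$⟩ˡ b))   ≡⟨ cong (P₁ ⟨$⟩ˡ_) (dart-conj d₂ b) ⟩
    P₁ ⟨$⟩ˡ (Q₁ ⟨$⟩ˡ (σ (dtgt X d₂) ⟨$⟩ˡ b))   ∎
    where
    open ≡-Reasoning
    P₁ = dperm {X} g₁ d₁
    P₂ = dperm {X} g₂ d₁
    Q₁ = dperm {X} g₁ d₂
    Q₂ = dperm {X} g₂ d₂

module KKMOIsomorphism (k q : ℕ) (X : Graph) (g₁ g₂ : SkCover X (suc k))
                       (iso : IsoCover X (suc k) g₁ g₂) where

  open ModularArithmetic q using (n; ℤ/n)
  open Differences ℤ/n using (shifted-difference)
  open Classes k q
  open Relabelling X g₁ g₂ iso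

  vertexShift : Fin (nV X) × Class → Fin n
  vertexShift (i , c) = rep c (σ i ⟨$⟩ˡ zero)

  target-commutes : ∀ s c → act (sqPerm {X} g₂ s) (act (σ (sqSrc X s)) c)
                          ≡ act (σ (sqTgt X s)) (act (sqPerm {X} g₁ s) c)
  target-commutes s c = begin
    pull (π₂ ⟨$⟩ˡ_) (pull (σ i ⟨$⟩ˡ_) c)      ≡⟨ pull-∘ (π₂ ⟨$⟩ˡ_) (σ i ⟨$⟩ˡ_) c ⟩
    pull (λ b → σ i ⟨$⟩ˡ (π₂ ⟨$⟩ˡ b)) c      ≡⟨ pull-cong c (sq-conj s) ⟩
    pull (λ b → π₁ ⟨$⟩ˡ (σ j ⟨$⟩ˡ b)) c      ≡⟨ pull-∘ (σ j ⟨$⟩ˡ_) (π₁ ⟨$⟩ˡ_) c ⟨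
    pull (σ j ⟨$⟩ˡ_) (pull (π₁ ⟨$⟩ˡ_) c)      ∎
    where
    open ≡-Reasoning
    i = sqSrc X s
    j = sqTgt X s
    π₁ = sqPerm {X} g₁ s
    π₂ = sqPerm {X} g₂ s

  label-shift : ∀ s c → kkmoLabel (sqPerm {X} g₂ s) (act (σ (sqSrc X s)) c)
                      ≡ (kkmoLabel (sqPerm {X} g₁ s) c +q vertexShift (sqSrc X s , c))
                          -q vertexShift (sqTgt X s , act (sqPerm {X} g₁ s) c)
  label-shift s c = begin
    zero -q rep (pull (σ i ⟨$⟩ˡ_) c) (π₂ ⟨$⟩ˡ zero)
      ≡⟨ cong (λ t → zero -q t) (rep-cls (rep c ∘ (σ i ⟨$⟩ˡ_)) (π₂ ⟨$⟩ˡ zero)) ⟩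
    zero -q (r (σ i ⟨$⟩ˡ (π₂ ⟨$⟩ˡ zero)) -q r a)
      ≡⟨ cong (λ t → zero -q (r t -q r a)) (sq-conj s zero) ⟩
    zero -q (r d -q r a)
      ≡⟨ shifted-difference (r a) (r b) (r d) ⟩
    ((zero -q r b) +q r a) -q (r d -q r b)
      ≡⟨ cong (λ t → ((zero -q r b) +q r a) -q t) (rep-cls (r ∘ (π₁ ⟨$⟩ˡ_)) (σ j ⟨$⟩ˡ zero)) ⟨
    ((zero -q r b) +q r a) -q rep (pull (π₁ ⟨$⟩ˡ_) c) (σ j ⟨$⟩ˡ zero)
      ∎
    where
    open ≡-Reasoning
    i = sqSrc X s
    j = sqTgt X s
    π₁ = sqPerm {X} g₁ s
    π₂ = sqPerm {X} g₂ s
    r = rep c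
    a = σ i ⟨$⟩ˡ zero
    b = π₁ ⟨$⟩ˡ zero
    d = π₁ ⟨$⟩ˡ (σ j ⟨$⟩ˡ zero)

  kkmoIso : CoverIso (KKMO K n X g₁) (KKMO K n X g₂)
  kkmoIso = record
    { φV   = fibrewise↔ (λ i → act↔ (σ i))
    ; φE   = fibrewise↔ (λ s → act↔ (σ (sqSrc X s)))
    ; c    = vertexShift
    ; resp = λ (s , c) →
        inj₁ (refl , cong (sqTgt X s ,_) (target-commutes s c) , label-shift s c)
    }

proposition19 : (k q : ℕ) → 2 ≤ k → 2 ≤ q →
    (X : Graph) (g₁ g₂ : SkCover X k) →
    IsoCover X k g₁ g₂ →
    Σ (CoverIso (KKMO k q X g₁) (KKMO k q X g₂)) λ ψ →
    ∀ (w : V (KKMO k q X g₁)) →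
    proj₁ (Inverse.to (CoverIso.φV ψ) w) ≡ proj₁ w
proposition19 (suc k) (suc q) (s≤s _) (s≤s _) X g₁ g₂ iso = kkmoIso , λ w → refl
  where open KKMOIsomorphism k q X g₁ g₂ iso
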